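{- The maps $\mathsf{BztoBw}_{\bullet}$ and $\mathsf{BwtoBz}$ are mutually inverse bijections between zigzag-free binary trees and black-white trees with black root: $\mathsf{BztoBw}_{\bullet}\circ\mathsf{BwtoBz}$ is the identity on black-white trees with black root and $\mathsf{BwtoBz}\circ\mathsf{BztoBw}_{\bullet}$ is the identity on zigzag-free binary trees.
   Context: Binary trees are finite rooted trees in which each node has an optional left child and an optional right child. A binary tree is zigzag-free if every node that is a left child of its parent and has no left child is a leaf. A black-white tree is a binary tree with nodes coloured black or white such that black nodes have no right child, a black node's left child may be of either colour, a white node's left child (if any) is white and its right child (if any) is black. "$t$ non-leaf" means $t$ has more than one node. $\mathsf{BwtoBz}$ (on black-white trees of either root colour): (1) single black node $\mapsto$ single node; (2) black root whose left subtree $t'$ has black root $\mapsto$ node with no left child and right subtree $\mathsf{BwtoBz}(t')$; (3) black root whose left subtree $t'$ has white root $\mapsto \mathsf{BwtoBz}(t')$; (4) single white node $\mapsto$ node whose only child is a left leaf; (5) white root with only left subtree $t'$ $\mapsto$ node with left subtree $\mathsf{BwtoBz}(t')$, no right child; (6) white root with only right subtree $t'$ $\mapsto$ node with left child a leaf and right subtree $\mathsf{BwtoBz}(t')$; (7) white root with left subtree $t'$ and right subtree $t''$ $\mapsto$ node with left subtree $\mathsf{BwtoBz}(t')$ and right subtree $\mathsf{BwtoBz}(t'')$. $\mathsf{BztoBw}_{\bullet}$: (1) single node $\mapsto$ single black node; (2) node with only right subtree $t$ $\mapsto$ black root with left subtree $\mathsf{BztoBw}_{\bullet}(t)$; (3)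 node whose only child is a left leaf $\mapsto$ black root whose left child is a single white node; (4) node with only a non-leaf left subtree $t$ $\mapsto$ black root whose left child is white with left subtree $\mathsf{BztoBw}_{\circ}(t)$; (5) node with left leaf and right subtree $t$ $\mapsto$ black root whose left child is white with no left child and right subtree $\mathsf{BztoBw}_{\bullet}(t)$; (6) node with non-leaf left subtree $t$ and right subtree $t'$ $\mapsto$ black root whose left child is white with left subtree $\mathsf{BztoBw}_{\circ}(t)$ and right subtree $\mathsf{BztoBw}_{\bullet}(t')$. $\mathsf{BztoBw}_{\circ}$ (on trees whose root has a left child): (1) node whose only child is a left leaf $\mapsto$ single white node; (2) node with left leaf and right subtree $t$ $\mapsto$ white root with right subtree $\mathsf{BztoBw}_{\bullet}(t)$; (3) node with only a non-leaf left subtree $t$ $\mapsto$ white root with left subtree $\mathsf{BztoBw}_{\circ}(t)$; (4) node with non-leaf left subtree $t$ and right subtree $t'$ $\mapsto$ white root with left subtree $\mathsf{BztoBw}_{\circ}(t)$ and right subtree $\mathsf{BztoBw}_{\bullet}(t')$. -}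

module Defs where

open import Data.Maybe using (Maybe; just; nothing)
open import Data.Unit using (⊤)
open import Data.Empty using (⊥)
open import Data.Product using (_×_)
open import Relation.Binary.PropositionalEquality using (_≡_)

data BT : Set where
  node : Maybe BT → Maybe BT → BT

leaf : BT
leaf = node nothing nothing

IsLeaf : BT → Set
IsLeaf (node nothing nothing) = ⊤
IsLeaf (node _ _)             = ⊥

LeftChildOK : BT → Set
LeftChildOK (node nothing r) = IsLeaf (node nothing r)
LeftChildOK (node (just _) _) = ⊤

-- Zigzag-free: every node that is a left child of its parent and has no
-- left child is a leaf.
ZigzagFree : BT → Set
ZigzagFree (node nothing  nothing)  = ⊤
ZigzagFree (node nothing  (just r)) = ZigzagFree r
ZigzagFree (node (just l) nothing)  = LeftChildOK l × ZigzagFree l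
ZigzagFree (node (just l) (just r)) = (LeftChildOK l × ZigzagFree l) × ZigzagFree r

data Colour : Set where
  black white : Colour

data CT : Set where
  cnode : Colour → Maybe CT → Maybe CT → CT

rootColour : CT → Colour
rootColour (cnode c _ _) = c

IsBW : CT → Set
IsBW (cnode black nothing  nothing)  = ⊤
IsBW (cnode black (just l) nothing)  = IsBW l
IsBW (cnode black _        (just _)) = ⊥
IsBW (cnode white nothing  nothing)  = ⊤
IsBW (cnode white (just l) nothing)  = (rootColour l ≡ white) × IsBW l
IsBW (cnode white nothing  (just r)) = (rootColour r ≡ black) × IsBW r
IsBW (cnode white (just l) (just r)) =
  ((rootColour l ≡ white) × IsBW l) × ((rootColour r ≡ black) × IsBW r)

-- Inputs that are not black-white trees (black node with a right child)
-- are handled by an arbitrary convention (the right child is ignored);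
-- the theorem only concerns black-white trees.

BwtoBz : CT → BT
BwtoBz (cnode black nothing _) = leaf
BwtoBz (cnode black (just (cnode black l r)) _) =
  node nothing (just (BwtoBz (cnode black l r)))
BwtoBz (cnode black (just (cnode white l r)) _) = BwtoBz (cnode white l r)
BwtoBz (cnode white nothing  nothing)   = node (just leaf) nothing
BwtoBz (cnode white (just t) nothing)   = node (just (BwtoBz t)) nothing
BwtoBz (cnode white nothing  (just t))  = node (just leaf) (just (BwtoBz t))
BwtoBz (cnode white (just t) (just t')) = node (just (BwtoBz t)) (just (BwtoBz t'))

-- BztoBw∘ is only meaningful on trees whose root
-- has a left child; on other inputs it returns an arbitrary value
-- (a single white node), which never matters for zigzag-free inputs.

BztoBw• : BT → CT
BztoBw∘ : BT → CT

BztoBw• (node nothing nothing)  = cnode black nothing nothing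
BztoBw• (node nothing (just t)) = cnode black (just (BztoBw• t)) nothing
BztoBw• (node (just (node nothing nothing)) nothing) =
  cnode black (just (cnode white nothing nothing)) nothing
BztoBw• (node (just (node nothing nothing)) (just t)) =
  cnode black (just (cnode white nothing (just (BztoBw• t)))) nothing
BztoBw• (node (just (node (just a) b)) nothing) =
  cnode black (just (cnode white (just (BztoBw∘ (node (just a) b))) nothing)) nothing
BztoBw• (node (just (node nothing (just b))) nothing) =
  cnode black (just (cnode white (just (BztoBw∘ (node nothing (just b)))) nothing)) nothing
BztoBw• (node (just (node (just a) b)) (just t')) =
  cnode black (just (cnode white (just (BztoBw∘ (node (just a) b)))
                                 (just (BztoBw• t')))) nothing
BztoBw• (node (just (node nothing (just b))) (just t')) =
  cnode black (just (cnode white (just (BztoBw∘ (node nothing (just b))))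
                                 (just (BztoBw• t')))) nothing

BztoBw∘ (node (just (node nothing nothing)) nothing) = cnode white nothing nothing
BztoBw∘ (node (just (node nothing nothing)) (just t)) =
  cnode white nothing (just (BztoBw• t))
BztoBw∘ (node (just (node (just a) b)) nothing) =
  cnode white (just (BztoBw∘ (node (just a) b))) nothing
BztoBw∘ (node (just (node nothing (just b))) nothing) =
  cnode white (just (BztoBw∘ (node nothing (just b)))) nothing
BztoBw∘ (node (just (node (just a) b)) (just t')) =
  cnode white (just (BztoBw∘ (node (just a) b))) (just (BztoBw• t'))
BztoBw∘ (node (just (node nothing (just b))) (just t')) =
  cnode white (just (BztoBw∘ (node nothing (just b)))) (just (BztoBw• t'))
BztoBw∘ (node nothing _) = cnode white nothing nothing

module Submission where

-- BwtoBz never distinguishes a black root with a white left child from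
-- that white child, and BztoBw• of a tree whose root has a left child is a
-- black node sitting on top of BztoBw∘ of the same tree.  So:
--
--  * On black-white trees, a black root round-trips through BztoBw•, and a
--    white root round-trips through BztoBw∘ (its image always has a left
--    child, which is what makes BztoBw∘ the right inverse there).
--  * On zigzag-free trees, BztoBw• yields a black-rooted black-white tree
--    and BztoBw∘ (for trees with a left child) a white-rooted one, and
--    BwtoBz undoes both.  The zigzag-free condition rules out exactly the
--    trees on which BztoBw∘ falls outside its intended domain.

open import Defs
open import Data.Product using (_×_; _,_)
open import Data.Maybe using (just; nothing)
open import Data.Unit using (⊤; tt)
open import Data.Empty using (⊥)
open import Relation.Binary.PropositionalEquality using (_≡_; refl; cong; cong₂; trans)

-- The root of a binary tree has a left child: the domain of BztoBw∘.
HasLeftChild : BT → Set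
HasLeftChild (node (just _) _) = ⊤
HasLeftChild (node nothing _)  = ⊥

hasLeftChild⇒leftChildOK : ∀ t → HasLeftChild t → LeftChildOK t
hasLeftChild⇒leftChildOK (node (just _) _) _ = tt

BztoBw•-hasLeftChild : ∀ t → HasLeftChild t →
  BztoBw• t ≡ cnode black (just (BztoBw∘ t)) nothing
BztoBw•-hasLeftChild (node (just (node nothing nothing)) nothing)     _ = refl
BztoBw•-hasLeftChild (node (just (node nothing nothing)) (just _))    _ = refl
BztoBw•-hasLeftChild (node (just (node nothing (just _))) nothing)    _ = refl
BztoBw•-hasLeftChild (node (just (node nothing (just _))) (just _))   _ = refl
BztoBw•-hasLeftChild (node (just (node (just _) _)) nothing)          _ = refl
BztoBw•-hasLeftChild (node (just (node (just _) _)) (just _))         _ = refl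

-- Rules (3) and (4) of BztoBw∘, stated for an arbitrary left subtree that
-- has a left child (the definition must split on its shape).
BztoBw∘-left : ∀ l → HasLeftChild l →
  BztoBw∘ (node (just l) nothing) ≡ cnode white (just (BztoBw∘ l)) nothing
BztoBw∘-left (node (just _) _) _ = refl

BztoBw∘-leftRight : ∀ l r → HasLeftChild l →
  BztoBw∘ (node (just l) (just r)) ≡ cnode white (just (BztoBw∘ l)) (just (BztoBw• r))
BztoBw∘-leftRight (node (just _) _) _ _ = refl

BwtoBz-blackOverBlack : ∀ s r → rootColour s ≡ black →
  BwtoBz (cnode black (just s) r) ≡ node nothing (just (BwtoBz s))
BwtoBz-blackOverBlack (cnode black _ _) _ refl = refl

BwtoBz-blackOverWhite : ∀ s r → rootColour s ≡ white →
  BwtoBz (cnode black (just s) r) ≡ BwtoBz s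
BwtoBz-blackOverWhite (cnode white _ _) _ refl = refl

bw-roundtrip• : ∀ t → IsBW t → rootColour t ≡ black →
  ZigzagFree (BwtoBz t) × BztoBw• (BwtoBz t) ≡ t
bw-roundtrip∘ : ∀ t → IsBW t → rootColour t ≡ white →
  HasLeftChild (BwtoBz t) × ZigzagFree (BwtoBz t) × BztoBw∘ (BwtoBz t) ≡ t

bw-roundtrip• (cnode black nothing nothing) _ refl = tt , refl
bw-roundtrip• (cnode black nothing (just _)) () refl
bw-roundtrip• (cnode black (just _) (just _)) () refl
bw-roundtrip• (cnode black (just l@(cnode black _ _)) nothing) bw refl
  with bw-roundtrip• l bw refl
... | zf , e = zf , cong (λ s → cnode black (just s) nothing) e
bw-roundtrip• (cnode black (just l@(cnode white _ _)) nothing) bw refl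
  with bw-roundtrip∘ l bw refl
... | hasLeft , zf , e =
  zf , trans (BztoBw•-hasLeftChild (BwtoBz l) hasLeft)
             (cong (λ s → cnode black (just s) nothing) e)

bw-roundtrip∘ (cnode white nothing nothing) _ refl = tt , (tt , tt) , refl
bw-roundtrip∘ (cnode white (just l@(cnode white _ _)) nothing) (refl , bw) refl
  with bw-roundtrip∘ l bw refl
... | hasLeft , zf , e =
  tt , (hasLeftChild⇒leftChildOK _ hasLeft , zf) ,
  trans (BztoBw∘-left (BwtoBz l) hasLeft) (cong (λ s → cnode white (just s) nothing) e)
bw-roundtrip∘ (cnode white nothing (just r@(cnode black _ _))) (refl , bw) refl
  with bw-roundtrip• r bw refl
... | zf , e = tt , ((tt , tt) , zf) , cong (λ s → cnode white nothing (just s)) e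
bw-roundtrip∘ (cnode white (just l@(cnode white _ _)) (just r@(cnode black _ _)))
              ((refl , bwl) , (refl , bwr)) refl
  with bw-roundtrip∘ l bwl refl | bw-roundtrip• r bwr refl
... | hasLeft , zfl , el | zfr , er =
  tt , ((hasLeftChild⇒leftChildOK _ hasLeft , zfl) , zfr) ,
  trans (BztoBw∘-leftRight (BwtoBz l) (BwtoBz r) hasLeft)
        (cong₂ (λ a b → cnode white (just a) (just b)) el er)

-- Transfer from the white half to the black half for trees with a left
-- child: BztoBw• wraps the white image in a black root, which BwtoBz ignores.
blackOverWhite-roundtrip : ∀ t → HasLeftChild t →
  IsBW (BztoBw∘ t) × rootColour (BztoBw∘ t) ≡ white × BwtoBz (BztoBw∘ t) ≡ t →
  (IsBW (BztoBw• t) × rootColour (BztoBw• t) ≡ black) × BwtoBz (BztoBw• t) ≡ t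
blackOverWhite-roundtrip t hasLeft (bw , isWhite , e)
  rewrite BztoBw•-hasLeftChild t hasLeft =
  (bw , refl) , trans (BwtoBz-blackOverWhite (BztoBw∘ t) nothing isWhite) e

-- Zigzag-free trees → black-white trees → zigzag-free trees.  The two
-- absurd clauses of the white half are the zigzags: a left child with only
-- a right child.
bz-roundtrip• : ∀ t → ZigzagFree t →
  (IsBW (BztoBw• t) × rootColour (BztoBw• t) ≡ black) × BwtoBz (BztoBw• t) ≡ t
bz-roundtrip∘ : ∀ t → HasLeftChild t → ZigzagFree t →
  IsBW (BztoBw∘ t) × rootColour (BztoBw∘ t) ≡ white × BwtoBz (BztoBw∘ t) ≡ t

bz-roundtrip• (node nothing nothing) _ = (tt , refl) , refl
bz-roundtrip• (node nothing (just r)) zf with bz-roundtrip• r zf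
... | (bw , isBlack) , e =
  (bw , refl) ,
  trans (BwtoBz-blackOverBlack (BztoBw• r) nothing isBlack) (cong (λ s → node nothing (just s)) e)
bz-roundtrip• t@(node (just _) _) zf = blackOverWhite-roundtrip t tt (bz-roundtrip∘ t tt zf)

bz-roundtrip∘ (node nothing _) () _
bz-roundtrip∘ (node (just (node nothing nothing)) nothing) _ _ = tt , refl , refl
bz-roundtrip∘ (node (just (node nothing nothing)) (just r)) _ (_ , zf)
  with bz-roundtrip• r zf
... | (bw , isBlack) , e = (isBlack , bw) , refl , cong (λ s → node (just leaf) (just s)) e
bz-roundtrip∘ (node (just (node nothing (just _))) nothing) _ (() , _)
bz-roundtrip∘ (node (just (node nothing (just _))) (just _)) _ ((() , _) , _)
bz-roundtrip∘ (node (just l@(node (just _) _)) nothing) _ (_ , zf)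
  with bz-roundtrip∘ l tt zf
... | bw , isWhite , e = (isWhite , bw) , refl , cong (λ s → node (just s) nothing) e
bz-roundtrip∘ (node (just l@(node (just _) _)) (just r)) _ ((_ , zfl) , zfr)
  with bz-roundtrip∘ l tt zfl | bz-roundtrip• r zfr
... | bwl , isWhite , el | (bwr , isBlack) , er =
  ((isWhite , bwl) , (isBlack , bwr)) , refl ,
  cong₂ (λ a b → node (just a) (just b)) el er

mainTheorem6 :
    ((t : CT) → IsBW t → rootColour t ≡ black →
       ZigzagFree (BwtoBz t) × BztoBw• (BwtoBz t) ≡ t)
    × ((t : BT) → ZigzagFree t →
       (IsBW (BztoBw• t) × rootColour (BztoBw• t) ≡ black) × BwtoBz (BztoBw• t) ≡ t)
mainTheorem6 = bw-roundtrip• , bz-roundtrip•
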